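{- Let $k\ge3$, let $H$ be a connected $k$-graph, $\alpha>0$, and let $B$ be an $\alpha$-normal weighted incidence matrix of $H$. Let $e=\{v_1,\dots,v_k\}$ be an edge of $H$ with $d_H(v_1)\ge2$. Then (1) $\alpha\le B(v_1,e)\le1-\alpha$; (2) if $d_H(v_1)\ge2$, $d_H(v_2)\ge2$ and $d_H(v_3)\ge2$, then $B(v_1,e)\ge\dfrac{\alpha}{(1-\alpha)^2}$.
   Context: A $k$-graph is a simple $k$-uniform hypergraph; $E_H(v)$ is the set of edges containing $v$ and $d_H(v)=|E_H(v)|$. A weighted incidence matrix of $H$ is a $|V|\times|E|$ matrix $B$ with $B(v,e)>0$ if $v\in e$ and $B(v,e)=0$ otherwise. $B$ is $\alpha$-normal if $\sum_{e\in E_H(v)}B(v,e)=1$ for every vertex $v$ and $\prod_{v\in e}B(v,e)=\alpha$ for every edge $e$. -}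

module Defs where

open import Level using (Level; _⊔_) renaming (suc to lsuc)
open import Data.Nat using (ℕ)
open import Data.Bool using (Bool; true; false)
open import Data.Fin as Fin using (Fin)
open import Data.Fin.Subset using (Subset; _∈_; ∣_∣)
open import Data.Vec using (Vec; []; _∷_; tabulate; lookup)
open import Data.Sum using (_⊎_)
open import Function using (_∘_)
open import Relation.Binary.Core using (Rel)
open import Relation.Binary.Structures using (IsStrictTotalOrder)
open import Relation.Binary.PropositionalEquality using (_≡_)
open import Relation.Nullary using (¬_)
open import Algebra.Bundles using (CommutativeRing)

-- An ordered field (the reals are one). Division is via a total inverse
-- function that is a genuine inverse on non-zero elements.
record OrderedField (c ℓ : Level) : Set (lsuc (c ⊔ ℓ)) where
  field
    commutativeRing : CommutativeRing c ℓ
  open CommutativeRing commutativeRing public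
  field
    _<_ : Rel Carrier ℓ
    <-isStrictTotalOrder : IsStrictTotalOrder _≈_ _<_
    0<1 : 0# < 1#
    +-monoˡ-< : ∀ {x y} z → x < y → (x + z) < (y + z)
    *-pos : ∀ {x y} → 0# < x → 0# < y → 0# < (x * y)
    _⁻¹ : Carrier → Carrier
    ⁻¹-inverse : ∀ x → ¬ (x ≈ 0#) → (x * (x ⁻¹)) ≈ 1#

  _≤_ : Rel Carrier ℓ
  x ≤ y = (x < y) ⊎ (x ≈ y)

  _/_ : Carrier → Carrier → Carrier
  x / y = x * (y ⁻¹)

record KGraph (k : ℕ) : Set where
  field
    n m : ℕ
    edge : Fin m → Subset n
    uniform : ∀ e → ∣ edge e ∣ ≡ k
    simple : ∀ e f → edge e ≡ edge f → e ≡ f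

  E : Fin n → Subset m
  E v = tabulate (λ e → lookup (edge e) v)

  d : Fin n → ℕ
  d v = ∣ E v ∣

  data Reach (u : Fin n) : Fin n → Set where
    here : Reach u u
    step : ∀ {v w} → Reach u v → (e : Fin m) → v ∈ edge e → w ∈ edge e → Reach u w

  Connected : Set
  Connected = ∀ u w → Reach u w

module OverField {c ℓ} (F : OrderedField c ℓ) where
  open OrderedField F

  sumOver : ∀ {m} → Subset m → (Fin m → Carrier) → Carrier
  sumOver [] f = 0#
  sumOver (true ∷ S) f = f Fin.zero + sumOver S (f ∘ Fin.suc)
  sumOver (false ∷ S) f = sumOver S (f ∘ Fin.suc)

  prodOver : ∀ {m} → Subset m → (Fin m → Carrier) → Carrier
  prodOver [] f = 1#
  prodOver (true ∷ S) f = f Fin.zero * prodOver S (f ∘ Fin.suc)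
  prodOver (false ∷ S) f = prodOver S (f ∘ Fin.suc)

  module _ {k : ℕ} (H : KGraph k) where
    open KGraph H

    IsWeightedIncidence : (Fin n → Fin m → Carrier) → Set ℓ
    IsWeightedIncidence B =
      (∀ v e → v ∈ edge e → 0# < B v e) × (∀ v e → ¬ (v ∈ edge e) → B v e ≈ 0#)
      where open import Data.Product using (_×_)

    IsNormal : Carrier → (Fin n → Fin m → Carrier) → Set ℓ
    IsNormal α B =
      IsWeightedIncidence B
      × (∀ v → sumOver (E v) (B v) ≈ 1#)
      × (∀ e → prodOver (edge e) (λ v → B v e) ≈ α)
      where open import Data.Product using (_×_)

{-# OPTIONS --safe #-}
-- Every entry B(v,e) is a nonnegative term of the vertex sum at v, which is 1, so
-- all entries lie in [0,1]. Hence α = ∏_{u∈e} B(u,e) ≤ B(v,e) for each v ∈ e, and if v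
-- lies in a second edge f, then 1 ≥ B(v,e) + B(v,f) ≥ B(v,e) + α. For (2), write
-- α = B(v₁,e) B(v₂,e) ∏_{u∈e∖{v₁,v₂}} B(u,e): the second factor is at most 1-α, and so
-- is the product, being at most B(v₃,e); since 1-α ≥ B(v₂,e) > 0 we may divide.
module Submission where

open import Defs
import Data.Nat as ℕ
open import Data.Nat using (s≤s)
open import Data.Nat.Properties using (n>0⇒n≢0)
open import Data.Fin using (Fin; zero; suc)
open import Data.Fin.Subset using (Subset; inside; outside; _∈_; _⊆_; ∣_∣; Nonempty) renaming (_-_ to _∖_)
open import Data.Fin.Subset.Properties
  using (⊆-refl; p─⊥≡p; p─q⊆p; x∈p∧x≢y⇒x∈p-y; x∈p∧x∉q⇒x∈p─q; ∉⊥; nonempty?; Empty-unique; ∣⊥∣≡0)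
open import Data.Vec using ([]; _∷_; here; there; lookup)
open import Data.Vec.Properties using ([]=⇒lookup; lookup⇒[]=; lookup∘tabulate)
open import Data.Product as Product using (_×_; _,_; proj₁; proj₂)
open import Data.Sum using (inj₁; inj₂)
open import Function using (_∘_)
open import Relation.Binary.Bundles using (StrictPartialOrder)
open import Relation.Binary.Definitions using (tri<; tri≈; tri>)
open import Relation.Binary.Structures using (IsStrictTotalOrder; IsPreorder)
open import Relation.Binary.PropositionalEquality as ≡ using (_≢_; cong)
open import Relation.Nullary using (¬_; yes; no; contradiction)
import Relation.Binary.Construct.StrictToNonStrict as StrictToNonStrict
import Relation.Binary.Reasoning.StrictPartialOrder as StrictPartialOrderReasoning

module OrderedFieldProperties {c ℓ} (F : OrderedField c ℓ) where
  open OrderedField F renaming (_<_ to infix 4 _<_; _≤_ to infix 4 _≤_; _⁻¹ to infix 8 _⁻¹; _/_ to infixl 7 _/_)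
  open import Algebra.Properties.Ring ring using (x[y-z]≈xy-xz)
  private
    module < = IsStrictTotalOrder <-isStrictTotalOrder

  <-strictPartialOrder : StrictPartialOrder c ℓ ℓ
  <-strictPartialOrder = record { isStrictPartialOrder = <.isStrictPartialOrder }

  ≤-isPreorder : IsPreorder _≈_ _≤_
  ≤-isPreorder = StrictToNonStrict.isPreorder₂ _≈_ _<_ <.isStrictPartialOrder

  open IsPreorder ≤-isPreorder public
    using () renaming (refl to ≤-refl; reflexive to ≤-reflexive)

  module ≤-Reasoning = StrictPartialOrderReasoning <-strictPartialOrder
  open ≤-Reasoning

  0<x⇒x≉0 : ∀ {x} → 0# < x → ¬ (x ≈ 0#)
  0<x⇒x≉0 0<x x≈0 = <.irrefl (sym x≈0) 0<x

  +-monoˡ-≤ : ∀ {x y} z → x ≤ y → x + z ≤ y + z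
  +-monoˡ-≤ z (inj₁ x<y) = inj₁ (+-monoˡ-< z x<y)
  +-monoˡ-≤ z (inj₂ x≈y) = inj₂ (+-congʳ x≈y)

  +-monoʳ-≤ : ∀ {x y} z → x ≤ y → z + x ≤ z + y
  +-monoʳ-≤ {x} {y} z x≤y = begin
    z + x  ≈⟨ +-comm z x ⟩
    x + z  ≤⟨ +-monoˡ-≤ z x≤y ⟩
    y + z  ≈⟨ +-comm y z ⟩
    z + y  ∎

  x≤x+y : ∀ {x y} → 0# ≤ y → x ≤ x + y
  x≤x+y {x} {y} 0≤y = begin
    x       ≈⟨ +-identityʳ x ⟨
    x + 0#  ≤⟨ +-monoʳ-≤ x 0≤y ⟩
    x + y   ∎

  +-nonneg : ∀ {x y} → 0# ≤ x → 0# ≤ y → 0# ≤ x + y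
  +-nonneg {x} {y} 0≤x 0≤y = begin
    0#      ≤⟨ 0≤x ⟩
    x       ≤⟨ x≤x+y 0≤y ⟩
    x + y   ∎

  x+z≤y⇒x≤y-z : ∀ {x y z} → x + z ≤ y → x ≤ y - z
  x+z≤y⇒x≤y-z {x} {y} {z} x+z≤y = begin
    x                ≈⟨ +-identityʳ x ⟨
    x + 0#           ≈⟨ +-congˡ (-‿inverseʳ z) ⟨
    x + (z - z)      ≈⟨ +-assoc x z (- z) ⟨
    (x + z) - z      ≤⟨ +-monoˡ-≤ (- z) x+z≤y ⟩
    y - z            ∎

  x<y⇒0<y-x : ∀ {x y} → x < y → 0# < y - x
  x<y⇒0<y-x {x} {y} x<y = begin-strict
    0#      ≈⟨ -‿inverseʳ x ⟨
    x - x   <⟨ +-monoˡ-< (- x) x<y ⟩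
    y - x   ∎

  0<y-x⇒x<y : ∀ {x y} → 0# < y - x → x < y
  0<y-x⇒x<y {x} {y} 0<y-x = begin-strict
    x              ≈⟨ +-identityˡ x ⟨
    0# + x         <⟨ +-monoˡ-< x 0<y-x ⟩
    (y - x) + x    ≈⟨ +-assoc y (- x) x ⟩
    y + (- x + x)  ≈⟨ +-congˡ (-‿inverseˡ x) ⟩
    y + 0#         ≈⟨ +-identityʳ y ⟩
    y              ∎

  *-monoˡ-≤ : ∀ {x y z} → 0# ≤ z → x ≤ y → z * x ≤ z * y
  *-monoˡ-≤ {x} {y} {z} (inj₂ 0≈z) _ = ≤-reflexive (begin-equality
    z * x   ≈⟨ *-congʳ 0≈z ⟨
    0# * x  ≈⟨ zeroˡ x ⟩
    0#      ≈⟨ zeroˡ y ⟨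
    0# * y  ≈⟨ *-congʳ 0≈z ⟩
    z * y   ∎)
  *-monoˡ-≤ (inj₁ 0<z) (inj₂ x≈y) = inj₂ (*-congˡ x≈y)
  *-monoˡ-≤ {x} {y} {z} (inj₁ 0<z) (inj₁ x<y) = inj₁ (0<y-x⇒x<y (begin-strict
    0#              <⟨ *-pos 0<z (x<y⇒0<y-x x<y) ⟩
    z * (y - x)     ≈⟨ x[y-z]≈xy-xz z y x ⟩
    z * y - z * x   ∎))

  *-monoʳ-≤ : ∀ {x y z} → 0# ≤ z → x ≤ y → x * z ≤ y * z
  *-monoʳ-≤ {x} {y} {z} 0≤z x≤y = begin
    x * z  ≈⟨ *-comm x z ⟩
    z * x  ≤⟨ *-monoˡ-≤ 0≤z x≤y ⟩
    z * y  ≈⟨ *-comm z y ⟩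
    y * z  ∎

  *-nonneg : ∀ {x y} → 0# ≤ x → 0# ≤ y → 0# ≤ x * y
  *-nonneg {x} {y} 0≤x 0≤y = begin
    0#      ≈⟨ zeroʳ x ⟨
    x * 0#  ≤⟨ *-monoˡ-≤ 0≤x 0≤y ⟩
    x * y   ∎

  x*y≤x : ∀ {x y} → 0# ≤ x → y ≤ 1# → x * y ≤ x
  x*y≤x {x} {y} 0≤x y≤1 = begin
    x * y   ≤⟨ *-monoˡ-≤ 0≤x y≤1 ⟩
    x * 1#  ≈⟨ *-identityʳ x ⟩
    x       ∎

  0<x⇒x⁻¹≰0 : ∀ {x} → 0# < x → ¬ (x ⁻¹ ≤ 0#)
  0<x⇒x⁻¹≰0 {x} 0<x x⁻¹≤0 = <.irrefl refl (begin-strict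
    0#        <⟨ 0<1 ⟩
    1#        ≈⟨ ⁻¹-inverse x (0<x⇒x≉0 0<x) ⟨
    x * x ⁻¹  ≤⟨ *-monoˡ-≤ (inj₁ 0<x) x⁻¹≤0 ⟩
    x * 0#    ≈⟨ zeroʳ x ⟩
    0#        ∎)

  0<x⇒0<x⁻¹ : ∀ {x} → 0# < x → 0# < x ⁻¹
  0<x⇒0<x⁻¹ {x} 0<x with <.compare 0# (x ⁻¹)
  ... | tri< 0<x⁻¹ _ _ = 0<x⁻¹
  ... | tri≈ _ 0≈x⁻¹ _ = contradiction (inj₂ (sym 0≈x⁻¹)) (0<x⇒x⁻¹≰0 0<x)
  ... | tri> _ _ x⁻¹<0 = contradiction (inj₁ x⁻¹<0) (0<x⇒x⁻¹≰0 0<x)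

  x≤y*z⇒x/z≤y : ∀ {x y z} → 0# < z → x ≤ y * z → x / z ≤ y
  x≤y*z⇒x/z≤y {x} {y} {z} 0<z x≤y*z = begin
    x * z ⁻¹          ≤⟨ *-monoʳ-≤ (inj₁ (0<x⇒0<x⁻¹ 0<z)) x≤y*z ⟩
    y * z * z ⁻¹      ≈⟨ *-assoc y z (z ⁻¹) ⟩
    y * (z * z ⁻¹)    ≈⟨ *-congˡ (⁻¹-inverse z (0<x⇒x≉0 0<z)) ⟩
    y * 1#            ≈⟨ *-identityʳ y ⟩
    y                 ∎

  InUnitInterval : Carrier → Set ℓ
  InUnitInterval x = 0# ≤ x × x ≤ 1#

  1-InUnitInterval : InUnitInterval 1#
  1-InUnitInterval = inj₁ 0<1 , ≤-refl

  *-InUnitInterval : ∀ {x y} → InUnitInterval x → InUnitInterval y → InUnitInterval (x * y)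
  *-InUnitInterval {x} {y} (0≤x , x≤1) (0≤y , y≤1) = *-nonneg 0≤x 0≤y , (begin
    x * y  ≤⟨ x*y≤x 0≤x y≤1 ⟩
    x      ≤⟨ x≤1 ⟩
    1#     ∎)


∣p∣>0⇒Nonempty : ∀ {m} (p : Subset m) → 0 ℕ.< ∣ p ∣ → Nonempty p
∣p∣>0⇒Nonempty {m} p 0<∣p∣ with nonempty? p
... | yes p≠∅ = p≠∅
... | no p=∅ = contradiction (≡.trans (cong ∣_∣ (Empty-unique p=∅)) (∣⊥∣≡0 m)) (n>0⇒n≢0 0<∣p∣)

x∈p∧1<∣p∣⇒Nonempty[p∖x] : ∀ {m} {p : Subset m} {x} → x ∈ p → 1 ℕ.< ∣ p ∣ → Nonempty (p ∖ x)
x∈p∧1<∣p∣⇒Nonempty[p∖x] {p = inside ∷ p} here (s≤s 0<∣p∣) =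
  Product.map suc (λ y∈p → there (x∈p∧x∉q⇒x∈p─q y∈p ∉⊥)) (∣p∣>0⇒Nonempty p 0<∣p∣)
x∈p∧1<∣p∣⇒Nonempty[p∖x] {p = inside ∷ p} (there x∈p) _ = zero , here
x∈p∧1<∣p∣⇒Nonempty[p∖x] {p = outside ∷ p} (there x∈p) 1<∣p∣ =
  Product.map suc there (x∈p∧1<∣p∣⇒Nonempty[p∖x] x∈p 1<∣p∣)

module BigOperatorProperties {c ℓ} (F : OrderedField c ℓ) where
  open OrderedField F hiding (zero) renaming (_≤_ to infix 4 _≤_)
  open OverField F
  open OrderedFieldProperties F
  open import Algebra.Properties.CommutativeSemigroup +-commutativeSemigroup
    using () renaming (x∙yz≈y∙xz to x+[y+z]≈y+[x+z])
  open import Algebra.Properties.CommutativeSemigroup *-commutativeSemigroup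
    using () renaming (x∙yz≈y∙xz to x*[y*z]≈y*[x*z])
  open ≤-Reasoning

  -- (inside ∷ p) ∖ zero computes to outside ∷ (p ─ ⊥), hence the appeal to p─⊥≡p.
  sumOver-∖ : ∀ {m} (p : Subset m) (f : Fin m → Carrier) {x} → x ∈ p →
              sumOver p f ≈ f x + sumOver (p ∖ x) f
  sumOver-∖ (inside ∷ p) f here =
    +-congˡ (reflexive (cong (λ q → sumOver q (f ∘ suc)) (≡.sym (p─⊥≡p p))))
  sumOver-∖ (inside ∷ p) f {suc x} (there x∈p) = begin-equality
    f zero + sumOver p (f ∘ suc)
      ≈⟨ +-congˡ (sumOver-∖ p (f ∘ suc) x∈p) ⟩
    f zero + (f (suc x) + sumOver (p ∖ x) (f ∘ suc))
      ≈⟨ x+[y+z]≈y+[x+z] _ _ _ ⟩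
    f (suc x) + (f zero + sumOver (p ∖ x) (f ∘ suc))  ∎
  sumOver-∖ (outside ∷ p) f (there x∈p) = sumOver-∖ p (f ∘ suc) x∈p

  prodOver-∖ : ∀ {m} (p : Subset m) (f : Fin m → Carrier) {x} → x ∈ p →
               prodOver p f ≈ f x * prodOver (p ∖ x) f
  prodOver-∖ (inside ∷ p) f here =
    *-congˡ (reflexive (cong (λ q → prodOver q (f ∘ suc)) (≡.sym (p─⊥≡p p))))
  prodOver-∖ (inside ∷ p) f {suc x} (there x∈p) = begin-equality
    f zero * prodOver p (f ∘ suc)
      ≈⟨ *-congˡ (prodOver-∖ p (f ∘ suc) x∈p) ⟩
    f zero * (f (suc x) * prodOver (p ∖ x) (f ∘ suc))
      ≈⟨ x*[y*z]≈y*[x*z] _ _ _ ⟩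
    f (suc x) * (f zero * prodOver (p ∖ x) (f ∘ suc))  ∎
  prodOver-∖ (outside ∷ p) f (there x∈p) = prodOver-∖ p (f ∘ suc) x∈p

  sumOver-nonneg : ∀ {m} (p : Subset m) (f : Fin m → Carrier) →
                   (∀ {x} → x ∈ p → 0# ≤ f x) → 0# ≤ sumOver p f
  sumOver-nonneg []            f nonneg = ≤-refl
  sumOver-nonneg (inside ∷ p)  f nonneg =
    +-nonneg (nonneg here) (sumOver-nonneg p (f ∘ suc) (nonneg ∘ there))
  sumOver-nonneg (outside ∷ p) f nonneg = sumOver-nonneg p (f ∘ suc) (nonneg ∘ there)

  prodOver-InUnitInterval : ∀ {m} (p : Subset m) (f : Fin m → Carrier) →
                            (∀ {x} → x ∈ p → InUnitInterval (f x)) →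
                            InUnitInterval (prodOver p f)
  prodOver-InUnitInterval []            f unit = 1-InUnitInterval
  prodOver-InUnitInterval (inside ∷ p)  f unit =
    *-InUnitInterval (unit here) (prodOver-InUnitInterval p (f ∘ suc) (unit ∘ there))
  prodOver-InUnitInterval (outside ∷ p) f unit =
    prodOver-InUnitInterval p (f ∘ suc) (unit ∘ there)

  f[x]≤sumOver : ∀ {m} (p : Subset m) (f : Fin m → Carrier) →
                 (∀ {y} → y ∈ p → 0# ≤ f y) → ∀ {x} → x ∈ p → f x ≤ sumOver p f
  f[x]≤sumOver p f nonneg {x} x∈p = begin
    f x                        ≤⟨ x≤x+y (sumOver-nonneg (p ∖ x) f (nonneg ∘ p─q⊆p _ _)) ⟩
    f x + sumOver (p ∖ x) f    ≈⟨ sumOver-∖ p f x∈p ⟨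
    sumOver p f                ∎

  prodOver≤f[x] : ∀ {m} (p : Subset m) (f : Fin m → Carrier) →
                  (∀ {y} → y ∈ p → InUnitInterval (f y)) → ∀ {x} → x ∈ p → prodOver p f ≤ f x
  prodOver≤f[x] p f unit {x} x∈p = begin
    prodOver p f                ≈⟨ prodOver-∖ p f x∈p ⟩
    f x * prodOver (p ∖ x) f    ≤⟨ x*y≤x (proj₁ (unit x∈p)) (proj₂ (prodOver-InUnitInterval (p ∖ x) f (unit ∘ p─q⊆p _ _))) ⟩
    f x                         ∎

module KGraphProperties {k} (H : KGraph k) where
  open KGraph H

  ∈-edge⇒∈-E : ∀ {v e} → v ∈ edge e → e ∈ E v
  ∈-edge⇒∈-E {v} {e} v∈e =
    lookup⇒[]= e (E v) (≡.trans (lookup∘tabulate (λ f → lookup (edge f) v) e) ([]=⇒lookup v∈e))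

  ∈-E⇒∈-edge : ∀ {v e} → e ∈ E v → v ∈ edge e
  ∈-E⇒∈-edge {v} {e} e∈Ev =
    lookup⇒[]= v (edge e) (≡.trans (≡.sym (lookup∘tabulate (λ f → lookup (edge f) v) e)) ([]=⇒lookup e∈Ev))

module NormalIncidenceProperties {c ℓ} (F : OrderedField c ℓ) {k} (H : KGraph k)
  {α : OrderedField.Carrier F} {B : Fin (KGraph.n H) → Fin (KGraph.m H) → OrderedField.Carrier F}
  (normal : OverField.IsNormal F H α B) where

  open OrderedField F hiding (zero) renaming (_≤_ to infix 4 _≤_; _<_ to infix 4 _<_; _/_ to infixl 7 _/_)
  open OverField F
  open OrderedFieldProperties F
  open BigOperatorProperties F
  open KGraph H
  open KGraphProperties H
  open ≤-Reasoning

  B-positive : ∀ {v e} → v ∈ edge e → 0# < B v e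
  B-positive = proj₁ (proj₁ normal) _ _

  vertex-sum : ∀ v → sumOver (E v) (B v) ≈ 1#
  vertex-sum = proj₁ (proj₂ normal)

  edge-product : ∀ e → prodOver (edge e) (λ u → B u e) ≈ α
  edge-product = proj₂ (proj₂ normal)

  B-nonneg : ∀ {v e} → v ∈ edge e → 0# ≤ B v e
  B-nonneg = inj₁ ∘ B-positive

  B≤sumOver : ∀ {v p f} → p ⊆ E v → f ∈ p → B v f ≤ sumOver p (B v)
  B≤sumOver {v} {p} p⊆Ev = f[x]≤sumOver p (B v) (B-nonneg ∘ ∈-E⇒∈-edge ∘ p⊆Ev)

  B≤1 : ∀ {v e} → v ∈ edge e → B v e ≤ 1#
  B≤1 {v} {e} v∈e = begin
    B v e                  ≤⟨ B≤sumOver ⊆-refl (∈-edge⇒∈-E v∈e) ⟩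
    sumOver (E v) (B v)    ≈⟨ vertex-sum v ⟩
    1#                     ∎

  prodOver≤B : ∀ {e p v} → p ⊆ edge e → v ∈ p → prodOver p (λ u → B u e) ≤ B v e
  prodOver≤B {e} {p} p⊆e = prodOver≤f[x] p (λ u → B u e) (λ u∈p → B-nonneg (p⊆e u∈p) , B≤1 (p⊆e u∈p))

  α≤B : ∀ {v e} → v ∈ edge e → α ≤ B v e
  α≤B {v} {e} v∈e = begin
    α                                  ≈⟨ edge-product e ⟨
    prodOver (edge e) (λ u → B u e)    ≤⟨ prodOver≤B ⊆-refl v∈e ⟩
    B v e                              ∎

  B≤1-α : ∀ {v e} → v ∈ edge e → 1 ℕ.< d v → B v e ≤ 1# - α
  B≤1-α {v} {e} v∈e 1<dv with x∈p∧1<∣p∣⇒Nonempty[p∖x] (∈-edge⇒∈-E v∈e) 1<dv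
  ... | f , f∈Ev∖e = x+z≤y⇒x≤y-z (begin
    B v e + α                          ≤⟨ +-monoʳ-≤ (B v e) (α≤B (∈-E⇒∈-edge (p─q⊆p _ _ f∈Ev∖e))) ⟩
    B v e + B v f                      ≤⟨ +-monoʳ-≤ (B v e) (B≤sumOver (p─q⊆p _ _) f∈Ev∖e) ⟩
    B v e + sumOver (E v ∖ e) (B v)    ≈⟨ sumOver-∖ (E v) (B v) (∈-edge⇒∈-E v∈e) ⟨
    sumOver (E v) (B v)                ≈⟨ vertex-sum v ⟩
    1#                                 ∎)

  α/[1-α]²≤B : ∀ {e v₁ v₂ v₃} → v₁ ∈ edge e → v₂ ∈ edge e → v₃ ∈ edge e →
               v₁ ≢ v₂ → v₁ ≢ v₃ → v₂ ≢ v₃ → 1 ℕ.< d v₂ → 1 ℕ.< d v₃ →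
               α / ((1# - α) * (1# - α)) ≤ B v₁ e
  α/[1-α]²≤B {e} {v₁} {v₂} {v₃} v₁∈e v₂∈e v₃∈e v₁≢v₂ v₁≢v₃ v₂≢v₃ 1<dv₂ 1<dv₃ =
    x≤y*z⇒x/z≤y (*-pos 0<1-α 0<1-α) (begin
      α                                 ≈⟨ edge-product e ⟨
      prodOver (edge e) b               ≈⟨ prodOver-∖ (edge e) b v₁∈e ⟩
      B v₁ e * prodOver p₁ b            ≈⟨ *-congˡ (prodOver-∖ p₁ b v₂∈p₁) ⟩
      B v₁ e * (B v₂ e * prodOver p₂ b) ≤⟨ *-monoˡ-≤ (B-nonneg v₁∈e) (*-monoˡ-≤ (B-nonneg v₂∈e) prodOver[p₂]≤1-α) ⟩
      B v₁ e * (B v₂ e * (1# - α))      ≤⟨ *-monoˡ-≤ (B-nonneg v₁∈e) (*-monoʳ-≤ (inj₁ 0<1-α) (B≤1-α v₂∈e 1<dv₂)) ⟩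
      B v₁ e * ((1# - α) * (1# - α))    ∎)
    where
    b : Fin n → Carrier
    b u = B u e
    p₁ p₂ : Subset n
    p₁ = edge e ∖ v₁
    p₂ = p₁ ∖ v₂
    v₂∈p₁ : v₂ ∈ p₁
    v₂∈p₁ = x∈p∧x≢y⇒x∈p-y v₂∈e (≡.≢-sym v₁≢v₂)
    v₃∈p₂ : v₃ ∈ p₂
    v₃∈p₂ = x∈p∧x≢y⇒x∈p-y (x∈p∧x≢y⇒x∈p-y v₃∈e (≡.≢-sym v₁≢v₃)) (≡.≢-sym v₂≢v₃)
    prodOver[p₂]≤1-α : prodOver p₂ b ≤ 1# - α
    prodOver[p₂]≤1-α = begin
      prodOver p₂ b   ≤⟨ prodOver≤B (p─q⊆p _ _ ∘ p─q⊆p _ _) v₃∈p₂ ⟩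
      B v₃ e          ≤⟨ B≤1-α v₃∈e 1<dv₃ ⟩
      1# - α          ∎
    0<1-α : 0# < 1# - α
    0<1-α = begin-strict
      0#       <⟨ B-positive v₂∈e ⟩
      B v₂ e   ≤⟨ B≤1-α v₂∈e 1<dv₂ ⟩
      1# - α   ∎

open import Data.Nat using (ℕ; _≤_)

proposition4p1 : ∀ {c ℓ} (F : OrderedField c ℓ) (k : ℕ) → 3 ≤ k →
    (H : KGraph k) → KGraph.Connected H →
    (α : OrderedField.Carrier F) → OrderedField._<_ F (OrderedField.0# F) α →
    (B : Fin (KGraph.n H) → Fin (KGraph.m H) → OrderedField.Carrier F) →
    OverField.IsNormal F H α B →
    (e : Fin (KGraph.m H)) (v₁ : Fin (KGraph.n H)) → v₁ ∈ KGraph.edge H e →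
    2 ≤ KGraph.d H v₁ →
    (OrderedField._≤_ F α (B v₁ e)
      × OrderedField._≤_ F (B v₁ e) (OrderedField._-_ F (OrderedField.1# F) α))
    × (∀ (v₂ v₃ : Fin (KGraph.n H)) → v₂ ∈ KGraph.edge H e → v₃ ∈ KGraph.edge H e →
        v₁ ≢ v₂ → v₁ ≢ v₃ → v₂ ≢ v₃ →
        2 ≤ KGraph.d H v₂ → 2 ≤ KGraph.d H v₃ →
        OrderedField._≤_ F
          (OrderedField._/_ F α
            (OrderedField._*_ F (OrderedField._-_ F (OrderedField.1# F) α)
                                (OrderedField._-_ F (OrderedField.1# F) α)))
          (B v₁ e))
proposition4p1 F k _ H _ α _ B normal e v₁ v₁∈e 1<dv₁ =
  (α≤B v₁∈e , B≤1-α v₁∈e 1<dv₁) ,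
  λ v₂ v₃ v₂∈e v₃∈e → α/[1-α]²≤B v₁∈e v₂∈e v₃∈e
  where open NormalIncidenceProperties F H normal
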